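{- Let $G$ be a finite simple graph on $N$ vertices, $\mathcal G$ a subgroup of its automorphism group, $k\ge N$ an integer, $o_1,\dots,o_p$ the orbits and $L$ the matrix described in the context, and $n\ge 1$. Let $P_{n+1}$ be the path on $n+1$ vertices. Then the number $\chi_{G\times P_{n+1}}(k)$ of proper $k$-colorings of $G\times P_{n+1}$ satisfies $$\chi_{G\times P_{n+1}}(k)=(w_1(k),\dots,w_p(k))\,L^n\,\mathbf 1,$$ where $w_i(k)$ is the number of colorings in $o_i$ and $\mathbf 1=(1,\dots,1)^t$.
   Context: A proper $k$-coloring of a graph is a map from its vertices to $[k]$ giving adjacent vertices different colors. Let $\mathcal C$ be the set of proper $k$-colorings of $G$. $\mathfrak S_k$ acts on $\mathcal C$ by permuting colors, with orbits $\tilde o_1,\dots,\tilde o_q$; $\mathcal G$ acts on $\mathcal C$ by $c\mapsto c\circ\sigma^{ -1}$, permuting the $\tilde o$'s, and the orbits of this action are $o_1,\dots,o_p$ (each identified with the set of colorings in the $\tilde o$'s it contains). The Cartesian product $G\times H$ has vertex set $V(G)\times V(H)$, with $(u,a)\sim(v,b)$ iff $u=v$ and $ab\in E(H)$, or $a=b$ and $uv\in E(G)$. $L$ is the $p\times p$ matrix whose $(o_i,o_j)$-entry is the number of proper $k$-colorings of $G\times P_2$ whose restriction to $G\times\{1\}$ equals a fixed representative $c\in o_i$ and whose restriction to $G\times\{2\}$ lies in $o_j$ (independent of the representative). -}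

module Defs where

open import Data.Nat using (ℕ; zero; suc; _+_; _*_)
open import Data.Fin using (Fin; zero; suc; toℕ)
open import Data.Fin.Permutation using (Permutation′; _⟨$⟩ʳ_; _⟨$⟩ˡ_; id; flip; _∘ₚ_)
open import Data.Product using (Σ; Σ-syntax; ∃; ∃-syntax; _×_; _,_)
open import Data.Sum using (_⊎_)
open import Relation.Nullary using (¬_; Dec)
open import Relation.Binary.PropositionalEquality using (_≡_; _≢_)

record SimpleGraph (V : Set) : Set₁ where
  field
    Adj    : V → V → Set
    sym    : ∀ {u v} → Adj u v → Adj v u
    irrefl : ∀ {u} → ¬ Adj u u
open SimpleGraph public

record FinSimpleGraph (N : ℕ) : Set₁ where
  field
    graph : SimpleGraph (Fin N)
    adj?  : ∀ u v → Dec (Adj graph u v)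
open FinSimpleGraph public

cartesian : ∀ {V W : Set} → SimpleGraph V → SimpleGraph W → SimpleGraph (V × W)
cartesian {V} {W} G H = record { Adj = A ; sym = s ; irrefl = ir }
  where
  A : V × W → V × W → Set
  A (u , a) (v , b) = (u ≡ v × Adj H a b) ⊎ (a ≡ b × Adj G u v)
  s : ∀ {x y} → A x y → A y x
  s (Data.Sum.inj₁ (Relation.Binary.PropositionalEquality.refl , h)) =
    Data.Sum.inj₁ (Relation.Binary.PropositionalEquality.refl , sym H h)
  s (Data.Sum.inj₂ (Relation.Binary.PropositionalEquality.refl , g)) =
    Data.Sum.inj₂ (Relation.Binary.PropositionalEquality.refl , sym G g)
  ir : ∀ {x} → ¬ A x x
  ir (Data.Sum.inj₁ (_ , h)) = irrefl H h
  ir (Data.Sum.inj₂ (_ , g)) = irrefl G g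

path : (m : ℕ) → SimpleGraph (Fin m)
path m = record { Adj = A ; sym = s ; irrefl = ir }
  where
  open import Data.Nat.Properties using (1+n≢n)
  A : Fin m → Fin m → Set
  A i j = (toℕ j ≡ suc (toℕ i)) ⊎ (toℕ i ≡ suc (toℕ j))
  s : ∀ {i j} → A i j → A j i
  s (Data.Sum.inj₁ e) = Data.Sum.inj₂ e
  s (Data.Sum.inj₂ e) = Data.Sum.inj₁ e
  ir : ∀ {i} → ¬ A i i
  ir {i} (Data.Sum.inj₁ e) = 1+n≢n (Relation.Binary.PropositionalEquality.sym e)
  ir {i} (Data.Sum.inj₂ e) = 1+n≢n (Relation.Binary.PropositionalEquality.sym e)

Proper : ∀ {V : Set} {k : ℕ} → SimpleGraph V → (V → Fin k) → Set
Proper G c = ∀ u v → Adj G u v → c u ≢ c v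

-- "the set {c : V → Fin k | P c} has exactly m elements", colorings being
-- compared pointwise: an explicit enumeration f of length m of pairwise
-- distinct elements satisfying P that exhausts P.
HasCard : ∀ {V : Set} {k : ℕ} → ((V → Fin k) → Set) → ℕ → Set
HasCard {V} {k} P m =
  Σ[ f ∈ (Fin m → (V → Fin k)) ]
    ((∀ i → P (f i))
    × (∀ i j → (∀ v → f i v ≡ f j v) → i ≡ j)
    × (∀ c → P c → ∃[ i ] (∀ v → f i v ≡ c v)))

IsAutomorphism : ∀ {N} → SimpleGraph (Fin N) → Permutation′ N → Set
IsAutomorphism G σ = ∀ u v →
  (Adj G u v → Adj G (σ ⟨$⟩ʳ u) (σ ⟨$⟩ʳ v)) × (Adj G (σ ⟨$⟩ʳ u) (σ ⟨$⟩ʳ v) → Adj G u v)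

record IsAutSubgroup {N} (G : SimpleGraph (Fin N)) (InG : Permutation′ N → Set) : Set where
  field
    aut   : ∀ σ → InG σ → IsAutomorphism G σ
    has-id : InG id
    closed-∘ : ∀ σ τ → InG σ → InG τ → InG (σ ∘ₚ τ)
    closed-inv : ∀ σ → InG σ → InG (flip σ)

-- d lies in the (𝔖_k × 𝒢)-orbit of c:  d = τ ∘ c ∘ σ⁻¹ for some color
-- permutation τ and some σ ∈ 𝒢
SameOrbit : ∀ {N k} → (Permutation′ N → Set) → (Fin N → Fin k) → (Fin N → Fin k) → Set
SameOrbit {N} {k} InG c d =
  Σ[ τ ∈ Permutation′ k ] Σ[ σ ∈ Permutation′ N ]
    (InG σ × (∀ u → d u ≡ τ ⟨$⟩ʳ (c (σ ⟨$⟩ˡ u))))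

sumFin : ∀ p → (Fin p → ℕ) → ℕ
sumFin zero    f = 0
sumFin (suc p) f = f zero + sumFin p (λ i → f (suc i))

matMul : ∀ {p} → (Fin p → Fin p → ℕ) → (Fin p → Fin p → ℕ) → Fin p → Fin p → ℕ
matMul {p} A B i j = sumFin p (λ l → A i l * B l j)

idMat : ∀ {p} → Fin p → Fin p → ℕ
idMat zero    zero    = 1
idMat zero    (suc j) = 0
idMat (suc i) zero    = 0
idMat (suc i) (suc j) = idMat i j

matPow : ∀ {p} → (Fin p → Fin p → ℕ) → ℕ → Fin p → Fin p → ℕ
matPow A zero    = idMat
matPow A (suc n) = matMul (matPow A n) A

rowMatOnes : ∀ {p} → (Fin p → ℕ) → (Fin p → Fin p → ℕ) → ℕ
rowMatOnes {p} w A = sumFin p (λ i → w i * sumFin p (λ j → A i j))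

-- A proper colouring of G × P_{n+2} is a proper colouring d of the bottom copy of G
-- followed by a proper colouring of G × P_{n+1} whose bottom layer differs from d at
-- every vertex. Symmetries of G and of the colour set act on everything, so the number
-- of colourings of G × P_{n+1} with a prescribed bottom layer d depends only on the
-- orbit o_j of d; call it b_n(j). Partitioning the second layer by its orbit o_i gives
-- b_{n+1}(j) = Σ_i L_{ji} b_n(i), where L_{ji} counts the colourings of o_i compatible
-- with d. Hence b_n = L^n 𝟏, and summing over the bottom layer gives χ = Σ_i w_i b_n(i).

module Submission where

open import Defs hiding (sym)
open import Data.Nat using (ℕ; zero; suc; _+_; _*_; _≤_; _≥_)
open import Data.Nat.Properties using (+-*-semiring; ≤-antisym; +-identityʳ; *-identityʳ; *-assoc)
import Data.Nat.Properties as ℕ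
open import Algebra.Properties.Semiring.Sum +-*-semiring
  using (sum; sum-syntax; sum-cong-≗; sum-replicate-zero; ∑-comm; *-distribˡ-sum; *-distribʳ-sum)
open import Data.Fin using (Fin; zero; suc; splitAt; join)
open import Data.Fin.Properties using (¬Fin0; injective⇒≤; splitAt-join; join-splitAt)
import Data.Fin.Properties as Fin
open import Data.Fin.Permutation using (Permutation′; _⟨$⟩ʳ_; _⟨$⟩ˡ_; flip; _∘ₚ_; inverseˡ; inverseʳ)
open import Data.Product using (∃; _×_; _,_; proj₁; proj₂)
open import Data.Sum using (_⊎_; inj₁; inj₂; [_,_]′)
open import Data.Unit using (⊤; tt)
open import Data.Empty using (⊥-elim)
open import Function using (_∘_)
open import Function.Bundles using (Injection)
open import Function.Properties.Inverse using (↔⇒↣)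
open import Relation.Nullary using (¬_)
open import Relation.Binary.PropositionalEquality

module _ {V : Set} {k : ℕ} where

  private
    Col : Set
    Col = V → Fin k

  HasCard-≤ : ∀ {P : Col → Set} {m m′} → HasCard P m → HasCard P m′ → m ≤ m′
  HasCard-≤ {P} {m} {m′} (f , f-P , f-inj , _) (g , _ , _ , g-onto) = injective⇒≤ index-inj
    where
    index : Fin m → Fin m′
    index i = proj₁ (g-onto (f i) (f-P i))

    g-index : ∀ i → g (index i) ≗ f i
    g-index i = proj₂ (g-onto (f i) (f-P i))

    index-inj : ∀ {i j} → index i ≡ index j → i ≡ j
    index-inj {i} {j} e = f-inj i j λ v →
      trans (sym (g-index i v)) (trans (cong (λ t → g t v) e) (g-index j v))

  HasCard-unique : ∀ {P : Col → Set} {m m′} → HasCard P m → HasCard P m′ → m ≡ m′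
  HasCard-unique P#m P#m′ = ≤-antisym (HasCard-≤ P#m P#m′) (HasCard-≤ P#m′ P#m)

  HasCard-⇔ : ∀ {P Q : Col → Set} {m} →
    (∀ {c} → P c → Q c) → (∀ {c} → Q c → P c) → HasCard P m → HasCard Q m
  HasCard-⇔ P⇒Q Q⇒P (f , f-P , f-inj , f-onto) =
    f , P⇒Q ∘ f-P , f-inj , λ c → f-onto c ∘ Q⇒P

  HasCard-empty : ∀ {P : Col → Set} → (∀ c → ¬ P c) → HasCard P 0
  HasCard-empty ¬P = (λ ()) , (λ ()) , (λ ()) , λ c → ⊥-elim ∘ ¬P c

  HasCard-singleton : ∀ {P : Col → Set} {d} → P d → (∀ {c} → P c → c ≗ d) → HasCard P 1
  HasCard-singleton {d = d} P-d unique =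
    (λ _ → d) , (λ _ → P-d) , (λ { zero zero _ → refl }) , λ c P-c → zero , sym ∘ unique P-c

  HasCard-⊎ : ∀ {P Q : Col → Set} {a b} → HasCard P a → HasCard Q b →
    (∀ {c d} → P c → Q d → ¬ c ≗ d) → HasCard (λ c → P c ⊎ Q c) (a + b)
  HasCard-⊎ {P} {Q} {a} {b} (f , f-P , f-inj , f-onto) (g , g-Q , g-inj , g-onto) disjoint =
    h ∘ splitAt a , h-P ∘ splitAt a , h∘splitAt-inj , h-onto
    where
    h : Fin a ⊎ Fin b → Col
    h = [ f , g ]′

    h-P : ∀ s → P (h s) ⊎ Q (h s)
    h-P (inj₁ i) = inj₁ (f-P i)
    h-P (inj₂ j) = inj₂ (g-Q j)

    h-inj : ∀ s t → h s ≗ h t → s ≡ t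
    h-inj (inj₁ i) (inj₁ j) e = cong inj₁ (f-inj i j e)
    h-inj (inj₁ i) (inj₂ j) e = ⊥-elim (disjoint (f-P i) (g-Q j) e)
    h-inj (inj₂ i) (inj₁ j) e = ⊥-elim (disjoint (f-P j) (g-Q i) (sym ∘ e))
    h-inj (inj₂ i) (inj₂ j) e = cong inj₂ (g-inj i j e)

    h∘splitAt-inj : ∀ x y → h (splitAt a x) ≗ h (splitAt a y) → x ≡ y
    h∘splitAt-inj x y e = begin
      x                         ≡⟨ join-splitAt a b x ⟨
      join a b (splitAt a x)    ≡⟨ cong (join a b) (h-inj (splitAt a x) (splitAt a y) e) ⟩
      join a b (splitAt a y)    ≡⟨ join-splitAt a b y ⟩
      y                         ∎
      where open ≡-Reasoning

    reach : ∀ {c} s → h s ≗ c → ∃ λ x → h (splitAt a x) ≗ c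
    reach s e = join a b s , λ v → trans (cong (λ t → h t v) (splitAt-join a b s)) (e v)

    h-onto : ∀ c → P c ⊎ Q c → ∃ λ x → h (splitAt a x) ≗ c
    h-onto c (inj₁ P-c) = let (i , e) = f-onto c P-c in reach (inj₁ i) e
    h-onto c (inj₂ Q-c) = let (j , e) = g-onto c Q-c in reach (inj₂ j) e

  HasCard-∑ : ∀ p {P : Col → Set} (Q : Fin p → Col → Set) {m : Fin p → ℕ} →
    (∀ t → HasCard (Q t) (m t)) →
    (∀ {t t′ c c′} → Q t c → Q t′ c′ → c ≗ c′ → t ≡ t′) →
    (∀ c → P c → ∃ λ t → Q t c) →
    (∀ {t c} → Q t c → P c) →
    HasCard P (∑[ t < p ] m t)
  HasCard-∑ zero Q _ _ cover _ = HasCard-empty λ c → ¬Fin0 ∘ proj₁ ∘ cover c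
  HasCard-∑ (suc p) {P} Q {m} Q#m disjoint cover sound =
    HasCard-⇔ to from (HasCard-⊎ (Q#m zero) Q′#m disjoint′)
    where
    Q′ : Col → Set
    Q′ c = ∃ λ t → Q (suc t) c

    Q′#m : HasCard Q′ (∑[ t < p ] m (suc t))
    Q′#m = HasCard-∑ p {Q′} (Q ∘ suc) (Q#m ∘ suc)
      (λ q q′ e → Fin.suc-injective (disjoint q q′ e)) (λ _ Q′-c → Q′-c) (λ {t} q → t , q)

    disjoint′ : ∀ {c d} → Q zero c → Q′ d → ¬ c ≗ d
    disjoint′ q (_ , q′) e with () ← disjoint q q′ e

    to : ∀ {c} → Q zero c ⊎ Q′ c → P c
    to (inj₁ q)       = sound q
    to (inj₂ (_ , q)) = sound q

    from : ∀ {c} → P c → Q zero c ⊎ Q′ c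
    from {c} P-c with cover c P-c
    ... | zero  , q = inj₁ q
    ... | suc t , q = inj₂ (t , q)

∑-const : ∀ m b → ∑[ i < m ] b ≡ m * b
∑-const zero    b = refl
∑-const (suc m) b = cong (b +_) (∑-const m b)

-- P is fibred over S, the fibre over e being Q e.
HasCard-fibred : ∀ {U V : Set} {j k : ℕ} {S : (U → Fin j) → Set} {P : (V → Fin k) → Set}
  (Q : (U → Fin j) → (V → Fin k) → Set) {m b : ℕ} →
  HasCard S m → (∀ {e} → S e → HasCard (Q e) b) →
  (∀ {e e′ c} → e ≗ e′ → Q e c → Q e′ c) →
  (∀ {e e′ c c′} → Q e c → Q e′ c′ → c ≗ c′ → e ≗ e′) →
  (∀ c → P c → ∃ λ e → S e × Q e c) →
  (∀ {e c} → S e → Q e c → P c) →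
  HasCard P (m * b)
HasCard-fibred {P = P} Q {m} {b} (f , f-S , f-inj , f-onto) fibre#b Q-resp Q-disjoint cover sound =
  subst (HasCard P) (∑-const m b)
    (HasCard-∑ m (Q ∘ f) (fibre#b ∘ f-S) (λ q q′ e → f-inj _ _ (Q-disjoint q q′ e)) cover′ (sound (f-S _)))
  where
  cover′ : ∀ c → P c → ∃ λ t → Q (f t) c
  cover′ c P-c with cover c P-c
  ... | e , S-e , q with f-onto e S-e
  ... | t , f-t≗e = t , Q-resp (sym ∘ f-t≗e) q

HasCard-bijection : ∀ {U V : Set} {j k : ℕ} {P : (U → Fin j) → Set} {Q : (V → Fin k) → Set} {m}
  (to : (U → Fin j) → (V → Fin k)) (from : (V → Fin k) → (U → Fin j)) →
  (∀ {c c′} → c ≗ c′ → to c ≗ to c′) → (∀ {c c′} → c ≗ c′ → from c ≗ from c′) →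
  (∀ {c} → P c → Q (to c)) → (∀ {c} → Q c → P (from c)) →
  (∀ {c} → P c → from (to c) ≗ c) → (∀ {c} → Q c → to (from c) ≗ c) →
  HasCard P m → HasCard Q m
HasCard-bijection {Q = Q} to from to-cong from-cong to-Q from-P from∘to to∘from (f , f-P , f-inj , f-onto) =
  to ∘ f , to-Q ∘ f-P , to∘f-inj , to∘f-onto
  where
  to∘f-inj : ∀ i j → to (f i) ≗ to (f j) → i ≡ j
  to∘f-inj i j e = f-inj i j λ v →
    trans (sym (from∘to (f-P i) v)) (trans (from-cong e v) (from∘to (f-P j) v))

  to∘f-onto : ∀ c → Q c → ∃ λ i → to (f i) ≗ c
  to∘f-onto c Q-c with f-onto (from c) (from-P Q-c)
  ... | i , f-i≗from-c = i , λ v → trans (to-cong f-i≗from-c v) (to∘from Q-c v)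

sumFin≡∑ : ∀ p (f : Fin p → ℕ) → sumFin p f ≡ ∑[ i < p ] f i
sumFin≡∑ zero    f = refl
sumFin≡∑ (suc p) f = cong (f zero +_) (sumFin≡∑ p (f ∘ suc))

Matrix : ℕ → Set
Matrix p = Fin p → Fin p → ℕ

infixr 7 _·_

_·_ : ∀ {p} → Matrix p → (Fin p → ℕ) → Fin p → ℕ
_·_ {p} A x i = ∑[ j < p ] (A i j * x j)

𝟏 : ∀ {p} → Fin p → ℕ
𝟏 _ = 1

·-congʳ : ∀ {p} (A : Matrix p) {x y : Fin p → ℕ} → x ≗ y → A · x ≗ A · y
·-congʳ A x≗y i = sum-cong-≗ (λ j → cong (A i j *_) (x≗y j))

idMat-· : ∀ {p} (x : Fin p → ℕ) → idMat · x ≗ x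
idMat-· {suc p} x zero =
  trans (cong (x zero + 0 +_) (sum-replicate-zero p)) (trans (+-identityʳ _) (+-identityʳ _))
idMat-· {suc p} x (suc i) = idMat-· (x ∘ suc) i

matMul-· : ∀ {p} (A B : Matrix p) (x : Fin p → ℕ) → matMul A B · x ≗ A · B · x
matMul-· {p} A B x i = begin
  ∑[ j < p ] (matMul A B i j * x j)              ≡⟨ sum-cong-≗ (λ j → cong (_* x j) (sumFin≡∑ p _)) ⟩
  ∑[ j < p ] (∑[ l < p ] (A i l * B l j) * x j)  ≡⟨ sum-cong-≗ (λ j → *-distribʳ-sum {p} (x j) _) ⟩
  ∑[ j < p ] ∑[ l < p ] (A i l * B l j * x j)    ≡⟨ ∑-comm {p} {p} _ ⟩
  ∑[ l < p ] ∑[ j < p ] (A i l * B l j * x j)    ≡⟨ sum-cong-≗ (λ l → sum-cong-≗ {p} (λ j → *-assoc (A i l) (B l j) (x j))) ⟩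
  ∑[ l < p ] ∑[ j < p ] (A i l * (B l j * x j))  ≡⟨ sum-cong-≗ (λ l → *-distribˡ-sum {p} (A i l) _) ⟨
  ∑[ l < p ] (A i l * ∑[ j < p ] (B l j * x j))  ∎
  where open ≡-Reasoning

matPow-suc-· : ∀ {p} (A : Matrix p) n (x : Fin p → ℕ) → matPow A (suc n) · x ≗ A · matPow A n · x
matPow-suc-· A zero x i = begin
  (matMul idMat A · x) i    ≡⟨ matMul-· idMat A x i ⟩
  (idMat · A · x) i         ≡⟨ idMat-· (A · x) i ⟩
  (A · x) i                 ≡⟨ ·-congʳ A (idMat-· x) i ⟨
  (A · idMat · x) i         ∎
  where open ≡-Reasoning
matPow-suc-· A (suc n) x i = begin
  (matMul (matPow A (suc n)) A · x) i    ≡⟨ matMul-· (matPow A (suc n)) A x i ⟩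
  (matPow A (suc n) · A · x) i           ≡⟨ matPow-suc-· A n (A · x) i ⟩
  (A · matPow A n · A · x) i             ≡⟨ ·-congʳ A (matMul-· (matPow A n) A x) i ⟨
  (A · matPow A (suc n) · x) i           ∎
  where open ≡-Reasoning

rowMatOnes≡∑ : ∀ {p} (w : Fin p → ℕ) (M : Matrix p) → rowMatOnes w M ≡ ∑[ i < p ] (w i * (M · 𝟏) i)
rowMatOnes≡∑ {p} w M = begin
  sumFin p (λ i → w i * sumFin p (M i))    ≡⟨ sumFin≡∑ p _ ⟩
  ∑[ i < p ] (w i * sumFin p (M i))        ≡⟨ sum-cong-≗ (λ i → cong (w i *_) (sumFin≡∑ p (M i))) ⟩
  ∑[ i < p ] (w i * ∑[ j < p ] M i j)      ≡⟨ sum-cong-≗ (λ i → cong (w i *_) (sum-cong-≗ (λ j → *-identityʳ (M i j)))) ⟨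
  ∑[ i < p ] (w i * (M · 𝟏) i)             ∎
  where open ≡-Reasoning

path-adj-suc : ∀ {n} {x y : Fin n} → Adj (path n) x y → Adj (path (suc n)) (suc x) (suc y)
path-adj-suc (inj₁ e) = inj₁ (cong suc e)
path-adj-suc (inj₂ e) = inj₂ (cong suc e)

path-adj-suc⁻¹ : ∀ {n} {x y : Fin n} → Adj (path (suc n)) (suc x) (suc y) → Adj (path n) x y
path-adj-suc⁻¹ (inj₁ e) = inj₁ (ℕ.suc-injective e)
path-adj-suc⁻¹ (inj₂ e) = inj₂ (ℕ.suc-injective e)

path-adj-zero : ∀ {n} {y : Fin (suc n)} → Adj (path (suc (suc n))) zero (suc y) → y ≡ zero
path-adj-zero {y = zero}  _        = refl
path-adj-zero {y = suc _} (inj₁ ())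
path-adj-zero {y = suc _} (inj₂ ())

module Colourings {N : ℕ} (G : SimpleGraph (Fin N)) {InG : Permutation′ N → Set}
                  (isG : IsAutSubgroup G InG) (k : ℕ) where

  open IsAutSubgroup isG

  Col : Set
  Col = Fin N → Fin k

  act : Permutation′ k → Permutation′ N → Col → Col
  act τ σ c = (τ ⟨$⟩ʳ_) ∘ c ∘ (σ ⟨$⟩ˡ_)

  act-cong : ∀ τ σ {c c′} → c ≗ c′ → act τ σ c ≗ act τ σ c′
  act-cong τ σ c≗c′ u = cong (τ ⟨$⟩ʳ_) (c≗c′ (σ ⟨$⟩ˡ u))

  act⁻¹-act : ∀ τ σ c → act (flip τ) (flip σ) (act τ σ c) ≗ c
  act⁻¹-act τ σ c u = trans (cong (λ v → τ ⟨$⟩ˡ (τ ⟨$⟩ʳ c v)) (inverseˡ σ)) (inverseˡ τ)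

  act-act⁻¹ : ∀ τ σ c → act τ σ (act (flip τ) (flip σ) c) ≗ c
  act-act⁻¹ τ σ c u = trans (cong (λ v → τ ⟨$⟩ʳ (τ ⟨$⟩ˡ c v)) (inverseʳ σ)) (inverseʳ τ)

  ⟨$⟩ʳ-injective : ∀ (τ : Permutation′ k) {x y} → τ ⟨$⟩ʳ x ≡ τ ⟨$⟩ʳ y → x ≡ y
  ⟨$⟩ʳ-injective τ = Injection.injective (↔⇒↣ τ)

  infix 4 _∼_

  _∼_ : Col → Col → Set
  _∼_ = SameOrbit InG

  ∼-act : ∀ τ {σ} → InG σ → ∀ c → c ∼ act τ σ c
  ∼-act τ {σ} σ∈G c = τ , σ , σ∈G , λ _ → refl

  ∼-sym : ∀ {c d} → c ∼ d → d ∼ c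
  ∼-sym {c} {d} (τ , σ , σ∈G , d≗τcσ⁻¹) = flip τ , flip σ , closed-inv σ σ∈G ,
    λ u → sym (trans (act-cong (flip τ) (flip σ) d≗τcσ⁻¹ u) (act⁻¹-act τ σ c u))

  ∼-trans : ∀ {c d e} → c ∼ d → d ∼ e → c ∼ e
  ∼-trans (τ , σ , σ∈G , d≗) (τ′ , σ′ , σ′∈G , e≗) =
    τ ∘ₚ τ′ , σ ∘ₚ σ′ , closed-∘ σ σ′ σ∈G σ′∈G , λ u → trans (e≗ u) (act-cong τ′ σ′ d≗ u)

  ∼-respʳ : ∀ {c d d′ : Col} → d ≗ d′ → c ∼ d → c ∼ d′
  ∼-respʳ d≗d′ (τ , σ , σ∈G , d≗) = τ , σ , σ∈G , λ u → trans (sym (d≗d′ u)) (d≗ u)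

  Proper-resp : ∀ {c c′ : Col} → c ≗ c′ → Proper G c → Proper G c′
  Proper-resp c≗c′ c-proper u v uv c′u≡c′v =
    c-proper u v uv (trans (c≗c′ u) (trans c′u≡c′v (sym (c≗c′ v))))

  Proper-act : ∀ τ {σ} → InG σ → ∀ {c} → Proper G c → Proper G (act τ σ c)
  Proper-act τ {σ} σ∈G c-proper u v uv eq =
    c-proper (σ ⟨$⟩ˡ u) (σ ⟨$⟩ˡ v) (proj₂ (aut σ σ∈G _ _) σσ⁻¹-adj) (⟨$⟩ʳ-injective τ eq)
    where
    σσ⁻¹-adj : Adj G (σ ⟨$⟩ʳ (σ ⟨$⟩ˡ u)) (σ ⟨$⟩ʳ (σ ⟨$⟩ˡ v))
    σσ⁻¹-adj = subst₂ (Adj G) (sym (inverseʳ σ)) (sym (inverseʳ σ)) uv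

  -- the condition imposed by the vertical edges between two consecutive layers
  Compatible : Col → Col → Set
  Compatible c d = ∀ u → c u ≢ d u

  Compatible-resp : ∀ {c c′ d d′ : Col} → c ≗ c′ → d ≗ d′ → Compatible c d → Compatible c′ d′
  Compatible-resp c≗c′ d≗d′ c#d u eq = c#d u (trans (c≗c′ u) (trans eq (sym (d≗d′ u))))

  Compatible-act : ∀ τ σ {c d} → Compatible c d → Compatible (act τ σ c) (act τ σ d)
  Compatible-act τ σ c#d u = c#d _ ∘ ⟨$⟩ʳ-injective τ

  Layered : ℕ → Set
  Layered n = Fin N × Fin (suc n) → Fin k

  ProperLayered : ∀ n → Layered n → Set
  ProperLayered n = Proper (cartesian G (path (suc n)))

  first : ∀ {n} → Layered n → Col
  first c u = c (u , zero)

  rest : ∀ {n} → Layered (suc n) → Layered n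
  rest c (u , x) = c (u , suc x)

  cons : ∀ {n} → Col → Layered n → Layered (suc n)
  cons d c (u , zero)  = d u
  cons d c (u , suc x) = c (u , x)

  single : Col → Layered 0
  single d (u , _) = d u

  StartingAt : ∀ n → Col → Layered n → Set
  StartingAt n d c = ProperLayered n c × first c ≗ d

  proper-first : ∀ {n} {c : Layered n} → ProperLayered n c → Proper G (first c)
  proper-first c-proper u v uv = c-proper (u , zero) (v , zero) (inj₂ (refl , uv))

  proper-rest : ∀ {n} {c : Layered (suc n)} → ProperLayered (suc n) c → ProperLayered n (rest c)
  proper-rest c-proper (u , x) (v , y) (inj₁ (u≡v , xy)) = c-proper _ _ (inj₁ (u≡v , path-adj-suc xy))
  proper-rest c-proper (u , x) (v , y) (inj₂ (x≡y , uv)) = c-proper _ _ (inj₂ (cong suc x≡y , uv))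

  compatible-first-rest : ∀ {n} {c : Layered (suc n)} → ProperLayered (suc n) c →
    Compatible (first c) (first (rest c))
  compatible-first-rest c-proper u = c-proper (u , zero) (u , suc zero) (inj₁ (refl , inj₁ refl))

  proper-single : ∀ {d} → Proper G d → ProperLayered 0 (single d)
  proper-single d-proper (u , zero) (v , zero) (inj₁ (_ , 0~0)) = ⊥-elim (irrefl (path 1) 0~0)
  proper-single d-proper (u , zero) (v , zero) (inj₂ (_ , uv))  = d-proper u v uv

  proper-cons : ∀ {n d} {c : Layered n} → Proper G d → ProperLayered n c → Compatible d (first c) →
    ProperLayered (suc n) (cons d c)
  proper-cons {n} {d} {c} d-proper c-proper d#c = go
    where
    go : ProperLayered (suc n) (cons d c)
    go (u , zero)  (v , zero)  (inj₁ (_ , 0~0))    = ⊥-elim (irrefl (path (suc (suc n))) 0~0)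
    go (u , zero)  (v , zero)  (inj₂ (_ , uv))     = d-proper u v uv
    go (u , zero)  (v , suc y) (inj₁ (refl , 0~y)) rewrite path-adj-zero 0~y = d#c u
    go (u , zero)  (v , suc y) (inj₂ (() , _))
    go (u , suc x) (v , zero)  (inj₁ (refl , x~0))
      rewrite path-adj-zero (SimpleGraph.sym (path (suc (suc n))) x~0) = d#c u ∘ sym
    go (u , suc x) (v , zero)  (inj₂ (() , _))
    go (u , suc x) (v , suc y) (inj₁ (u≡v , xy))   = c-proper (u , x) (v , y) (inj₁ (u≡v , path-adj-suc⁻¹ xy))
    go (u , suc x) (v , suc y) (inj₂ (x≡y , uv))   = c-proper (u , x) (v , y) (inj₂ (Fin.suc-injective x≡y , uv))

  module OrbitCounting
    (p : ℕ) (rep : Fin p → Col) (rep-proper : ∀ i → Proper G (rep i))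
    (rep-distinct : ∀ i j → rep i ∼ rep j → i ≡ j)
    (rep-cover : ∀ c → Proper G c → ∃ λ i → rep i ∼ c)
    (L : Matrix p)
    (L-count : ∀ i j →
      HasCard (λ c → ProperLayered 1 c × first c ≗ rep i × rep j ∼ first (rest c)) (L i j))
    where

    InOrbit : Fin p → Col → Set
    InOrbit i e = Proper G e × rep i ∼ e

    orbit-unique : ∀ {i j e e′} → rep i ∼ e → rep j ∼ e′ → e ≗ e′ → i ≡ j
    orbit-unique {i} {j} {e} i∼e j∼e′ e≗e′ =
      rep-distinct i j (∼-trans {rep i} {e} i∼e (∼-sym {rep j} (∼-respʳ {rep j} (sym ∘ e≗e′) j∼e′)))

    Extension : Fin p → Col → Col → Set
    Extension i d e = InOrbit i e × Compatible d e

    Extension-resp : ∀ {i d d′ e} → d ≗ d′ → Extension i d e → Extension i d′ e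
    Extension-resp d≗d′ (e-orbit , d#e) = e-orbit , Compatible-resp d≗d′ (λ _ → refl) d#e

    extensions-rep : ∀ i j → HasCard (Extension i (rep j)) (L j i)
    extensions-rep i j =
      HasCard-bijection (first ∘ rest) (cons (rep j) ∘ single) to-cong from-cong to-P from-P from∘to to∘from
        (L-count j i)
      where
      to-cong : ∀ {c c′ : Layered 1} → c ≗ c′ → first (rest c) ≗ first (rest c′)
      to-cong c≗c′ u = c≗c′ (u , suc zero)

      from-cong : ∀ {e e′} → e ≗ e′ → cons (rep j) (single e) ≗ cons (rep j) (single e′)
      from-cong e≗e′ (u , zero)     = refl
      from-cong e≗e′ (u , suc zero) = e≗e′ u

      to-P : ∀ {c} → ProperLayered 1 c × first c ≗ rep j × rep i ∼ first (rest c) →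
        Extension i (rep j) (first (rest c))
      to-P (c-proper , c₀≗ , i∼c₁) = (proper-first (proper-rest c-proper) , i∼c₁) ,
        Compatible-resp c₀≗ (λ _ → refl) (compatible-first-rest c-proper)

      from-P : ∀ {e} → Extension i (rep j) e →
        ProperLayered 1 (cons (rep j) (single e)) × first (cons (rep j) (single e)) ≗ rep j × rep i ∼ e
      from-P ((e-proper , i∼e) , j#e) =
        proper-cons (rep-proper j) (proper-single e-proper) j#e , (λ _ → refl) , i∼e

      from∘to : ∀ {c} → ProperLayered 1 c × first c ≗ rep j × rep i ∼ first (rest c) →
        cons (rep j) (single (first (rest c))) ≗ c
      from∘to (_ , c₀≗ , _) (u , zero)     = sym (c₀≗ u)
      from∘to (_ , c₀≗ , _) (u , suc zero) = refl

      to∘from : ∀ {e} → Extension i (rep j) e → first (rest (cons (rep j) (single e))) ≗ e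
      to∘from _ _ = refl

    extensions-act : ∀ i τ {σ} → InG σ → ∀ {d m} →
      HasCard (Extension i d) m → HasCard (Extension i (act τ σ d)) m
    extensions-act i τ {σ} σ∈G {d} =
      HasCard-bijection (act τ σ) (act (flip τ) (flip σ)) (act-cong τ σ) (act-cong (flip τ) (flip σ))
        to-P from-P (λ {e} _ → act⁻¹-act τ σ e) (λ {e} _ → act-act⁻¹ τ σ e)
      where
      to-P : ∀ {e} → Extension i d e → Extension i (act τ σ d) (act τ σ e)
      to-P {e} ((e-proper , i∼e) , d#e) =
        (Proper-act τ σ∈G e-proper , ∼-trans {rep i} {e} i∼e (∼-act τ σ∈G e)) , Compatible-act τ σ d#e

      from-P : ∀ {e} → Extension i (act τ σ d) e → Extension i d (act (flip τ) (flip σ) e)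
      from-P {e} ((e-proper , i∼e) , σd#e) =
        (Proper-act (flip τ) σ⁻¹∈G e-proper , ∼-trans {rep i} {e} i∼e (∼-act (flip τ) σ⁻¹∈G e)) ,
        Compatible-resp (act⁻¹-act τ σ d) (λ _ → refl) (Compatible-act (flip τ) (flip σ) σd#e)
        where σ⁻¹∈G = closed-inv σ σ∈G

    extensions : ∀ i j {d} → rep j ∼ d → HasCard (Extension i d) (L j i)
    extensions i j (τ , σ , σ∈G , d≗) =
      HasCard-⇔ (Extension-resp (sym ∘ d≗)) (Extension-resp d≗) (extensions-act i τ σ∈G (extensions-rep i j))

    -- T is a condition on the bottom layer; b i counts the colourings over a bottom layer in o_i.
    HasCard-layered : ∀ n (b : Fin p → ℕ) → (∀ i {e} → InOrbit i e → HasCard (StartingAt n e) (b i)) →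
      (T : Col → Set) → (∀ {e e′} → e ≗ e′ → T e → T e′) →
      (a : Fin p → ℕ) → (∀ i → HasCard (λ e → InOrbit i e × T e) (a i)) →
      HasCard (λ c → ProperLayered n c × T (first c)) (∑[ i < p ] (a i * b i))
    HasCard-layered n b start#b T T-resp a a-count =
      HasCard-∑ p piece piece#ab piece-disjoint cover proj₁
      where
      piece : Fin p → Layered n → Set
      piece i c = (ProperLayered n c × T (first c)) × rep i ∼ first c

      piece#ab : ∀ i → HasCard (piece i) (a i * b i)
      piece#ab i = HasCard-fibred (StartingAt n) (a-count i) (start#b i ∘ proj₁)
        (λ e≗e′ (c-proper , c₀≗e) → c-proper , λ u → trans (c₀≗e u) (e≗e′ u))
        (λ (_ , c₀≗e) (_ , c′₀≗e′) c≗c′ u → trans (sym (c₀≗e u)) (trans (c≗c′ (u , zero)) (c′₀≗e′ u)))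
        (λ c ((c-proper , T-c₀) , i∼c₀) → first c , ((proper-first c-proper , i∼c₀) , T-c₀) , c-proper , λ _ → refl)
        (λ ((_ , i∼e) , T-e) (c-proper , c₀≗e) → (c-proper , T-resp (sym ∘ c₀≗e) T-e) , ∼-respʳ {rep i} (sym ∘ c₀≗e) i∼e)

      piece-disjoint : ∀ {i j c c′} → piece i c → piece j c′ → c ≗ c′ → i ≡ j
      piece-disjoint (_ , i∼c₀) (_ , j∼c′₀) c≗c′ = orbit-unique i∼c₀ j∼c′₀ (λ u → c≗c′ (u , zero))

      cover : ∀ c → ProperLayered n c × T (first c) → ∃ λ i → piece i c
      cover c (c-proper , T-c₀) with rep-cover (first c) (proper-first c-proper)
      ... | i , i∼c₀ = i , (c-proper , T-c₀) , i∼c₀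

    StartingAt-count : ∀ n j {d} → InOrbit j d → HasCard (StartingAt n d) ((matPow L n · 𝟏) j)
    StartingAt-count zero j {d} (d-proper , _) =
      subst (HasCard _) (sym (idMat-· 𝟏 j)) (HasCard-singleton (proper-single d-proper , λ _ → refl) unique)
      where
      unique : ∀ {c} → StartingAt 0 d c → c ≗ single d
      unique (_ , c₀≗d) (u , zero) = c₀≗d u
    StartingAt-count (suc n) j {d} (d-proper , j∼d) =
      subst (HasCard _) (sym (matPow-suc-· L n 𝟏 j))
        (HasCard-bijection (cons d) rest cons-cong rest-cong cons-P rest-P (λ _ _ → refl) cons∘rest
          (HasCard-layered n _ (StartingAt-count n) (Compatible d) (Compatible-resp (λ _ → refl))
            (λ i → L j i) (λ i → extensions i j j∼d)))
      where
      cons-cong : ∀ {c c′ : Layered n} → c ≗ c′ → cons d c ≗ cons d c′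
      cons-cong c≗c′ (u , zero)  = refl
      cons-cong c≗c′ (u , suc x) = c≗c′ (u , x)

      rest-cong : ∀ {c c′ : Layered (suc n)} → c ≗ c′ → rest c ≗ rest c′
      rest-cong c≗c′ (u , x) = c≗c′ (u , suc x)

      cons-P : ∀ {c} → ProperLayered n c × Compatible d (first c) → StartingAt (suc n) d (cons d c)
      cons-P (c-proper , d#c₀) = proper-cons d-proper c-proper d#c₀ , λ _ → refl

      rest-P : ∀ {c} → StartingAt (suc n) d c → ProperLayered n (rest c) × Compatible d (first (rest c))
      rest-P (c-proper , c₀≗d) =
        proper-rest c-proper , Compatible-resp c₀≗d (λ _ → refl) (compatible-first-rest c-proper)

      cons∘rest : ∀ {c} → StartingAt (suc n) d c → cons d (rest c) ≗ c
      cons∘rest (_ , c₀≗d) (u , zero)  = sym (c₀≗d u)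
      cons∘rest (_ , c₀≗d) (u , suc x) = refl

    ProperLayered-count : ∀ n (w : Fin p → ℕ) → (∀ i → HasCard (InOrbit i) (w i)) →
      HasCard (ProperLayered n) (∑[ i < p ] (w i * (matPow L n · 𝟏) i))
    ProperLayered-count n w w-count =
      HasCard-⇔ proj₁ (_, tt)
        (HasCard-layered n _ (StartingAt-count n) (λ _ → ⊤) _ w (λ i → HasCard-⇔ (_, tt) proj₁ (w-count i)))

corollary5p20 :
    ∀ (N : ℕ) (G : FinSimpleGraph N)
      (InG : Permutation′ N → Set) → IsAutSubgroup (graph G) InG →
    ∀ (k : ℕ) → k ≥ N →
    ∀ (n : ℕ) → n ≥ 1 →
    ∀ (p : ℕ) (rep : Fin p → (Fin N → Fin k)) →
      (∀ i → Proper (graph G) (rep i)) →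
      (∀ i j → SameOrbit InG (rep i) (rep j) → i ≡ j) →
      (∀ c → Proper (graph G) c → ∃ λ i → SameOrbit InG (rep i) c) →
    ∀ (w : Fin p → ℕ) →
      (∀ i → HasCard (λ c → Proper (graph G) c × SameOrbit InG (rep i) c) (w i)) →
    ∀ (L : Fin p → Fin p → ℕ) →
      (∀ i j → HasCard
        (λ (c : Fin N × Fin 2 → Fin k) →
           Proper (cartesian (graph G) (path 2)) c
           × (∀ u → c (u , zero) ≡ rep i u)
           × SameOrbit InG (rep j) (λ u → c (u , suc zero)))
        (L i j)) →
    ∀ (χ : ℕ) →
      HasCard {Fin N × Fin (suc n)} {k} (Proper (cartesian (graph G) (path (suc n)))) χ →
    χ ≡ rowMatOnes w (matPow L n)
corollary5p20 N G InG isG k _ n _ p rep rep-proper rep-distinct rep-cover w w-count L L-count χ χ-count =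
  begin
    χ                                          ≡⟨ HasCard-unique χ-count (ProperLayered-count n w w-count) ⟩
    ∑[ i < p ] (w i * (matPow L n · 𝟏) i)      ≡⟨ rowMatOnes≡∑ w (matPow L n) ⟨
    rowMatOnes w (matPow L n)                  ∎
  where
  open ≡-Reasoning
  open Colourings (graph G) isG k
  open OrbitCounting p rep rep-proper rep-distinct rep-cover L L-count
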